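{- Let $t$ and $u$ be terms. If $t\equiv u$ then for every stack $\pi$ and every substitution $\sigma$ we have $t\sigma\ast\pi\Downarrow_{\rightsquigarrow}\Leftrightarrow u\sigma\ast\pi\Downarrow_{\rightsquigarrow}$.
   Context: Fix pairwise disjoint countably infinite sets of $\lambda$-variables ($x,y,\dots$), stack variables ($\alpha,\beta,\dots$), term variables ($a,b,\dots$), and countable sets of labels $l$ and constructors $C$. Values, terms, stacks, processes: $v,w::=x\mid\lambda x\,t\mid C[v]\mid\{l_i=v_i\}_{i\in I}$; $t,u::=a\mid v\mid t\,u\mid\mu\alpha\,t\mid p\mid v.l\mid\mathrm{case}_v[C_i[x_i]\to t_i]_{i\in I}\mid\delta_{v,w}$; $\pi::=\alpha\mid v.\pi\mid[t]\pi$; $p::=t\ast\pi$; $I$ finite; $\lambda x$, $\mu\alpha$ and the $x_i$ in case branches are binders, term variables are never bound. Substitutions map $\lambda$-variables to values, stack variables to stacks, term variables to terms (capture-avoiding). $\succ$ is the smallest relation on processes with: $t\,u\ast\pi\succ u\ast[t]\pi$; $v\ast[t]\pi\succ t\ast v.\pi$; $\lambda x\,t\ast v.\pi\succ t[x:=v]\ast\pi$; $\mu\alpha\,t\ast\pi\succ t[\alpha:=\pi]\ast\pi$; $p\ast\pi\succ p$; $\{l_i=v_i\}_{i\in I}.l_k\ast\pi\succ v_k\ast\pi$ ($k\in I$); $\mathrm{case}_{C_k[v]}[C_i[x_i]\to t_i]_{i\in I}\ast\pi\succ t_k[x_k:=v]\ast\pi$ ($k\in I$). A process is final if it is $v\ast\alpha$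 with $v$ a value and $\alpha$ a stack variable; for a relation $R$, $p\Downarrow_R$ means $p\,R^*\,q$ with $q$ final. For $i\in\mathbb N$, inductively: $\rightsquigarrow_i=\succ\cup\{(\delta_{v,w}\ast\pi,v\ast\pi)\mid\exists j<i,\ v\not\equiv_jw\}$; $t\equiv_iu$ iff for all $j\le i$, stacks $\pi$, substitutions $\sigma$: $t\sigma\ast\pi\Downarrow_{\rightsquigarrow_j}\Leftrightarrow u\sigma\ast\pi\Downarrow_{\rightsquigarrow_j}$; $\not\equiv_i$ is its negation. $\rightsquigarrow=\bigcup_i\rightsquigarrow_i$, $\equiv=\bigcap_i\equiv_i$. -}

module Defs where

open import Data.Nat using (ℕ; zero; suc)
open import Data.Fin using (Fin)
open import Data.Empty using (⊥)
open import Data.Sum using (_⊎_)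
open import Data.Product using (Σ; _×_; _,_)
open import Function using (id; _∘_)
open import Relation.Nullary using (¬_)
open import Relation.Binary.PropositionalEquality using (_≡_)
open import Relation.Binary.Construct.Closure.ReflexiveTransitive using (Star)
open import Function.Definitions using (Injective)
open import Function.Bundles using (_⇔_)

-- Binders (λx, μα, the x_i of case branches) use de Bruijn
-- indices: λ-variables and stack variables are two separate index spaces
-- (index 0 = innermost binder of that sort).  Term variables are never
-- bound and are plain names (ℕ).
-- A record {l_i = v_i}_{i∈I} and a case [C_i[x_i] → t_i]_{i∈I} are given
-- by a finite index set Fin n and an injective labelling (distinct labels
-- / constructors).

Label : Set
Label = ℕ

Constr : Set
Constr = ℕ

mutual
  data Value : Set where
    var  : ℕ → Value
    lam  : Term → Value
    con  : Constr → Value → Value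
    rcd  : (n : ℕ) (ls : Fin n → Label) → Injective _≡_ _≡_ ls →
           (Fin n → Value) → Value

  data Term : Set where
    tvar  : ℕ → Term
    val   : Value → Term
    app   : Term → Term → Term
    mu    : Term → Term
    proc  : Proc → Term
    proj  : Value → Label → Term
    case  : Value → (n : ℕ) (cs : Fin n → Constr) → Injective _≡_ _≡_ cs →
            (Fin n → Term) → Term
    delta : Value → Value → Term

  data Stack : Set where
    svar  : ℕ → Stack
    push  : Value → Stack → Stack
    frame : Term → Stack → Stack

  data Proc : Set where
    _∗_ : Term → Stack → Proc

infix 4 _∗_

ext : (ℕ → ℕ) → ℕ → ℕ
ext r zero    = zero
ext r (suc n) = suc (r n)

mutual
  renV : (ℕ → ℕ) → (ℕ → ℕ) → Value → Value
  renV rl rs (var x)          = var (rl x)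
  renV rl rs (lam t)          = lam (renT (ext rl) rs t)
  renV rl rs (con c v)        = con c (renV rl rs v)
  renV rl rs (rcd n ls i vs)  = rcd n ls i (λ k → renV rl rs (vs k))

  renT : (ℕ → ℕ) → (ℕ → ℕ) → Term → Term
  renT rl rs (tvar a)            = tvar a
  renT rl rs (val v)             = val (renV rl rs v)
  renT rl rs (app t u)           = app (renT rl rs t) (renT rl rs u)
  renT rl rs (mu t)              = mu (renT rl (ext rs) t)
  renT rl rs (proc p)            = proc (renP rl rs p)
  renT rl rs (proj v l)          = proj (renV rl rs v) l
  renT rl rs (case v n cs i ts)  = case (renV rl rs v) n cs i (λ k → renT (ext rl) rs (ts k))
  renT rl rs (delta v w)         = delta (renV rl rs v) (renV rl rs w)

  renS : (ℕ → ℕ) → (ℕ → ℕ) → Stack → Stack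
  renS rl rs (svar α)    = svar (rs α)
  renS rl rs (push v π)  = push (renV rl rs v) (renS rl rs π)
  renS rl rs (frame t π) = frame (renT rl rs t) (renS rl rs π)

  renP : (ℕ → ℕ) → (ℕ → ℕ) → Proc → Proc
  renP rl rs (t ∗ π) = renT rl rs t ∗ renS rl rs π

record Subst : Set where
  field
    onλ : ℕ → Value
    onα : ℕ → Stack
    ona : ℕ → Term
open Subst public

liftλ : Subst → Subst
onλ (liftλ σ) zero    = var zero
onλ (liftλ σ) (suc n) = renV suc id (onλ σ n)
onα (liftλ σ) n       = renS suc id (onα σ n)
ona (liftλ σ) a       = renT suc id (ona σ a)

liftα : Subst → Subst
onλ (liftα σ) n       = renV id suc (onλ σ n)
onα (liftα σ) zero    = svar zero
onα (liftα σ) (suc n) = renS id suc (onα σ n)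
ona (liftα σ) a       = renT id suc (ona σ a)

mutual
  subV : Subst → Value → Value
  subV σ (var x)         = onλ σ x
  subV σ (lam t)         = lam (subT (liftλ σ) t)
  subV σ (con c v)       = con c (subV σ v)
  subV σ (rcd n ls i vs) = rcd n ls i (λ k → subV σ (vs k))

  subT : Subst → Term → Term
  subT σ (tvar a)           = ona σ a
  subT σ (val v)            = val (subV σ v)
  subT σ (app t u)          = app (subT σ t) (subT σ u)
  subT σ (mu t)             = mu (subT (liftα σ) t)
  subT σ (proc p)           = proc (subP σ p)
  subT σ (proj v l)         = proj (subV σ v) l
  subT σ (case v n cs i ts) = case (subV σ v) n cs i (λ k → subT (liftλ σ) (ts k))
  subT σ (delta v w)        = delta (subV σ v) (subV σ w)

  subS : Subst → Stack → Stack
  subS σ (svar α)    = onα σ α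
  subS σ (push v π)  = push (subV σ v) (subS σ π)
  subS σ (frame t π) = frame (subT σ t) (subS σ π)

  subP : Subst → Proc → Proc
  subP σ (t ∗ π) = subT σ t ∗ subS σ π

[0:=_]λ : Value → Subst
onλ [0:= v ]λ zero    = v
onλ [0:= v ]λ (suc n) = var n
onα [0:= v ]λ α       = svar α
ona [0:= v ]λ a       = tvar a

[0:=_]α : Stack → Subst
onλ [0:= π ]α x       = var x
onα [0:= π ]α zero    = π
onα [0:= π ]α (suc n) = svar n
ona [0:= π ]α a       = tvar a

infix 3 _≻_
data _≻_ : Proc → Proc → Set where
  ≻-app  : ∀ {t u π} → app t u ∗ π ≻ u ∗ frame t π
  ≻-push : ∀ {v t π} → val v ∗ frame t π ≻ t ∗ push v π
  ≻-β    : ∀ {t v π} → val (lam t) ∗ push v π ≻ subT [0:= v ]λ t ∗ π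
  ≻-μ    : ∀ {t π} → mu t ∗ π ≻ subT [0:= π ]α t ∗ π
  ≻-proc : ∀ {p π} → proc p ∗ π ≻ p
  ≻-proj : ∀ {n} {ls : Fin n → Label} {inj : Injective _≡_ _≡_ ls} {vs π} (k : Fin n) →
           proj (rcd n ls inj vs) (ls k) ∗ π ≻ val (vs k) ∗ π
  ≻-case : ∀ {n} {cs : Fin n → Constr} {inj : Injective _≡_ _≡_ cs} {ts v π} (k : Fin n) →
           case (con (cs k) v) n cs inj ts ∗ π ≻ subT [0:= v ]λ (ts k) ∗ π

data DeltaStep (D : Value → Value → Set) : Proc → Proc → Set where
  δ-step : ∀ {v w π} → D v w → DeltaStep D (delta v w ∗ π) (val v ∗ π)

data Final : Proc → Set where
  final : ∀ v α → Final (val v ∗ svar α)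

_⇓[_] : Proc → (Proc → Proc → Set) → Set
p ⇓[ R ] = Σ Proc (λ q → Star R p q × Final q)

-- The stratified relations ⇝_i and ≡_i.
-- "∀ j ≤ i" and "∃ j < i" are unfolded by recursion on i
-- (needed for structural termination).

mutual
  _⇝[_]_ : Proc → ℕ → Proc → Set
  p ⇝[ i ] q = (p ≻ q) ⊎ DeltaStep (NotEquivBelow i) p q

  AgreeAt : ℕ → Term → Term → Set
  AgreeAt j t u = (π : Stack) (σ : Subst) →
    ((subT σ t ∗ π) ⇓[ (λ p q → p ⇝[ j ] q) ]) ⇔ ((subT σ u ∗ π) ⇓[ (λ p q → p ⇝[ j ] q) ])

  _≣[_]_ : Term → ℕ → Term → Set
  t ≣[ zero ]  u = AgreeAt zero t u
  t ≣[ suc i ] u = (t ≣[ i ] u) × AgreeAt (suc i) t u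

  NotEquivBelow : ℕ → Value → Value → Set
  NotEquivBelow zero    v w = ⊥
  NotEquivBelow (suc i) v w = NotEquivBelow i v w ⊎ ¬ (val v ≣[ i ] val w)

_⇝_ : Proc → Proc → Set
p ⇝ q = Σ ℕ (λ i → p ⇝[ i ] q)

_≣_ : Term → Term → Set
t ≣ u = (i : ℕ) → t ≣[ i ] u

module Submission where

open import Defs
open import Data.Nat using (zero; suc; _≤_; _≤′_; ≤′-refl; ≤′-step; _⊔_)
open import Data.Nat.Properties using (≤⇒≤′; m≤m⊔n; m≤n⊔m)
open import Data.Product using (∃; _,_; proj₂)
open import Data.Product.Function.Dependent.Propositional using (congˡ)
open import Data.Sum using (inj₁; inj₂)
open import Function.Bundles using (_⇔_; mk⇔)
import Function.Properties.Equivalence as ⇔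
open import Relation.Binary.Construct.Closure.ReflexiveTransitive as Star using (Star; ε; _◅_)

-- Any ⇝-reduction uses finitely many steps, each a ⇝ᵢ-step for some i, and the
-- ⇝ᵢ grow with i; so ⇝-termination is ⇝ᵢ-termination for some i, and ≡ᵢ
-- identifies the latter for t σ ∗ π and u σ ∗ π at every i.

NotEquivBelow-mono : ∀ {i j v w} → i ≤′ j → NotEquivBelow i v w → NotEquivBelow j v w
NotEquivBelow-mono ≤′-refl        d = d
NotEquivBelow-mono (≤′-step i≤′j) d = inj₁ (NotEquivBelow-mono i≤′j d)

⇝[]-mono : ∀ {i j p q} → i ≤ j → p ⇝[ i ] q → p ⇝[ j ] q
⇝[]-mono i≤j (inj₁ s)          = inj₁ s
⇝[]-mono i≤j (inj₂ (δ-step d)) = inj₂ (δ-step (NotEquivBelow-mono (≤⇒≤′ i≤j) d))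

Star⇝⇒Star⇝[] : ∀ {p q} → Star _⇝_ p q → ∃ λ i → Star (_⇝[ i ]_) p q
Star⇝⇒Star⇝[] ε                = 0 , ε
Star⇝⇒Star⇝[] ((i , s) ◅ steps) with Star⇝⇒Star⇝[] steps
... | j , steps′ = i ⊔ j , ⇝[]-mono (m≤m⊔n i j) s ◅ Star.map (⇝[]-mono (m≤n⊔m i j)) steps′

⇓⇔∃⇓[] : ∀ {p} → p ⇓[ _⇝_ ] ⇔ ∃ λ i → p ⇓[ _⇝[ i ]_ ]
⇓⇔∃⇓[] = mk⇔ bounded unbounded
  where
  bounded : ∀ {p} → p ⇓[ _⇝_ ] → ∃ λ i → p ⇓[ _⇝[ i ]_ ]
  bounded (q , steps , q-final) with Star⇝⇒Star⇝[] steps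
  ... | i , steps′ = i , q , steps′ , q-final

  unbounded : ∀ {p} → (∃ λ i → p ⇓[ _⇝[ i ]_ ]) → p ⇓[ _⇝_ ]
  unbounded (i , q , steps , q-final) = q , Star.map (i ,_) steps , q-final

≣[]⇒AgreeAt : ∀ {t u} i → t ≣[ i ] u → AgreeAt i t u
≣[]⇒AgreeAt zero    t≣u = t≣u
≣[]⇒AgreeAt (suc i) t≣u = proj₂ t≣u

theorem1 : (t u : Term) → t ≣ u → (π : Stack) (σ : Subst) →
    ((subT σ t ∗ π) ⇓[ _⇝_ ]) ⇔ ((subT σ u ∗ π) ⇓[ _⇝_ ])
theorem1 t u t≣u π σ =
  ⇔.trans ⇓⇔∃⇓[] (⇔.trans (congˡ λ {i} → ≣[]⇒AgreeAt i (t≣u i) π σ) (⇔.sym ⇓⇔∃⇓[]))
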